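{- Let $\mathcal R$ be a registry with range $\{1,\dots,n\}$ in which every singlet family forms by itself a block of $\mathcal R$. Let $\mathcal R'$ be obtained by removing all singlet families from $\mathcal R$, and then reinsert the elements of the complement of the range of $\mathcal R'$ in $\{1,\dots,n\}$ by the reinsertion procedure. The resulting registry is $\mathcal R$.
   Context: A family is either a singlet $(s)$ or a nonsinglet family: a set of $\ge2$ positive integers colored red/blue with $\ge1$ red, $\ge1$ blue, every red larger than every blue. A registry is a finite sequence $(F_1,\dots,F_k)$ of pairwise disjoint families; its range is $\bigcup_i F_i$. Blocks of a registry: let $i_1$ be the index of the family containing the minimum of all elements; let $i_2$ be the index of the family containing the minimum of $\bigcup_{i>i_1}F_i$; and so on; the blocks are $(F_{i_{t-1}+1},\dots,F_{i_t})$ (with $i_0=0$), their minima increasing from left to right. Reinsertion procedure: given a registry $\mathcal R'$ without singlets and a set $S\subseteq\{1,\dots,n\}$ disjoint from its range, insert the elements $s\in S$ one at a time in increasing order, each time placing the singlet family $(s)$ immediately after the last block (of the current registry) whose minimum is smaller than $s$, or at the very beginning if there is no such block. -}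

module Defs where

open import Data.Nat using (ℕ; zero; suc; _⊓_; _≤_; _<_; _≡ᵇ_; _<ᵇ_; _≟_)
open import Data.Bool using (Bool; true; false; if_then_else_)
open import Data.List using (List; []; _∷_; [_]; _++_; concatMap; concat; map; foldr; length; take; drop; filter; upTo)
open import Data.List.Relation.Unary.All using (All)
open import Data.List.Relation.Unary.Unique.Propositional using (Unique)
open import Data.List.Membership.Propositional using (_∈_)
open import Data.List.Membership.DecPropositional _≟_ using (_∈?_)
open import Data.Product using (_×_; _,_)
open import Relation.Nullary using (¬_; ¬?)
open import Relation.Binary.PropositionalEquality using (_≡_)

data Family : Set where
  singlet : ℕ → Family
  nonsinglet : (blues reds : List ℕ) → Family

elems : Family → List ℕ
elems (singlet s) = [ s ]
elems (nonsinglet b r) = b ++ r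

data NonEmpty : List ℕ → Set where
  nonEmpty : ∀ {x xs} → NonEmpty (x ∷ xs)

-- Well-formedness of a single family (its elements are distinct:
-- this is imposed at registry level via Unique of the whole range).
WFFamily : Family → Set
WFFamily (singlet s) = 1 ≤ s
WFFamily (nonsinglet b r) =
  All (1 ≤_) (b ++ r) × NonEmpty b × NonEmpty r
  × (∀ {x y} → x ∈ b → y ∈ r → x < y)

Registry : Set
Registry = List Family

rangeL : Registry → List ℕ
rangeL R = concatMap elems R

WFRegistry : Registry → Set
WFRegistry R = All WFFamily R × Unique (rangeL R)

-- minimum of a list of naturals (0 for the empty list; never used on [])
minL : List ℕ → ℕ
minL [] = 0
minL (x ∷ xs) = foldr _⊓_ x xs

fmin : Family → ℕ
fmin F = minL (elems F)

cut : ℕ → List Family → List Family × List Family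
cut m [] = [] , []
cut m (F ∷ Fs) with fmin F ≡ᵇ m
... | true = [ F ] , Fs
... | false with cut m Fs
...   | a , b = F ∷ a , b

-- blocks, computed with fuel (fuel = number of families suffices)
blocksF : ℕ → Registry → List (List Family)
blocksF zero _ = []
blocksF (suc k) [] = []
blocksF (suc k) (F ∷ Fs) with cut (minL (rangeL (F ∷ Fs))) (F ∷ Fs)
... | a , b = a ∷ blocksF k b

blocks : Registry → List (List Family)
blocks R = blocksF (length R) R

bmin : List Family → ℕ
bmin B = minL (rangeL B)

-- number of leading blocks up to and including the last block with min < s
cnt : ℕ → List (List Family) → ℕ
cnt s [] = 0
cnt s (B ∷ Bs) with cnt s Bs
... | suc c = suc (suc c)
... | zero = if bmin B <ᵇ s then 1 else 0

insertSinglet : ℕ → Registry → Registry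
insertSinglet s R =
  let bs = blocks R
      c = cnt s bs
  in concat (take c bs) ++ singlet s ∷ concat (drop c bs)

reinsert : List ℕ → Registry → Registry
reinsert [] R = R
reinsert (s ∷ S) R = reinsert S (insertSinglet s R)

removeSinglets : Registry → Registry
removeSinglets [] = []
removeSinglets (singlet _ ∷ R) = removeSinglets R
removeSinglets (nonsinglet b r ∷ R) = nonsinglet b r ∷ removeSinglets R

complementIn : ℕ → Registry → List ℕ
complementIn n R = filter (λ x → ¬? (x ∈? rangeL R)) (map suc (upTo n))

HasRange : Registry → ℕ → Set
HasRange R n = ∀ x → (x ∈ rangeL R → 1 ≤ x × x ≤ n) × (1 ≤ x × x ≤ n → x ∈ rangeL R)

SingletsAreBlocks : Registry → Set
SingletsAreBlocks R = ∀ {B} → B ∈ blocks R → ∀ {s} → singlet s ∈ B → B ≡ [ singlet s ]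

module Submission where

-- Call a list Bs of family lists a block list when every B in Bs ends
-- with the first family attaining the minimum of everything from B onwards.
-- The function blocks recovers Bs from concat Bs, and the blocks of any
-- registry form a block list whose concatenation is the registry.  If a
-- block of a block list with distinct elements is the singlet [ s ], the
-- blocks before it have minimum < s and those after it minimum at least s;
-- so deleting that block leaves a block list, and inserting s into what is
-- left puts [ s ] back exactly where it was.  Peeling the reinserted
-- elements off from the right, induction shows that reinserting the singlet
-- elements of such a block list, in any order, into its singlet-free part
-- gives back its concatenation.  The theorem follows because the complement
-- of the range of the singlet-free part of R in {1..n} lists precisely the
-- singlet elements of R.

open import Defs
open import Data.Nat using (ℕ; zero; suc; _⊓_; _≤_; _<_; _<?_; _≟_; z≤n; s≤s; s≤s⁻¹)
open import Data.Nat.Properties using (m⊓n≤m; m⊓n≤n; ⊓-sel; ≤-refl; ≤-trans; ≤-antisym; ≤∧≢⇒<; ≤⇒≯; suc-injective)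
open import Data.Unit using (⊤; tt)
open import Data.Empty using (⊥-elim)
open import Data.List using (List; []; _∷_; [_]; _++_; _∷ʳ_; concat; map; foldr; length; take; drop; upTo)
open import Data.List.Properties using (concatMap-++; concat-++; ++-assoc; ++-identityʳ; ++-conicalʳ; length-++-≤ʳ)
open import Data.List.Relation.Unary.All using (All; []; _∷_; lookup; tabulate)
import Data.List.Relation.Unary.All as All
open import Data.List.Relation.Unary.All.Properties using (All¬⇒¬Any; ++⁻ʳ)
open import Data.List.Relation.Unary.Any using (Any; here; there)
open import Data.List.Relation.Unary.Any.Properties using (¬Any[])
import Data.List.Relation.Unary.First as First
open import Data.List.Relation.Unary.First.Properties using (¬All⇒First; toView)
open import Data.List.Relation.Unary.AllPairs using (_∷_)
open import Data.List.Relation.Unary.Unique.Propositional using (Unique)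
open import Data.List.Relation.Unary.Unique.Propositional.Properties using (filter⁺; map⁺; upTo⁺)
open import Data.List.Membership.Propositional using (_∈_; _∉_; lose; find)
open import Data.List.Membership.Propositional.Properties using (∈-++⁺ˡ; ∈-++⁺ʳ; ∈-++⁻; ∈-insert; ∈-∃++; ∈-concat⁺′; ∈-concat⁻′; ∈-concatMap⁺; ∈-concatMap⁻; ∈-map⁺; ∈-map⁻; ∈-upTo⁺; ∈-upTo⁻; ∈-filter⁺; ∈-filter⁻)
open import Data.List.Membership.DecPropositional _≟_ using (_∈?_)
open import Data.List.Relation.Binary.Subset.Propositional using (_⊆_)
open import Data.List.Relation.Binary.Subset.Propositional.Properties using (⊆-respʳ-↭; xs⊆x∷xs; xs⊆xs++ys; xs⊆ys++xs; concat⁺; concatMap⁺)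
open import Data.List.Relation.Binary.Permutation.Propositional using (↭-sym)
open import Data.List.Relation.Binary.Permutation.Propositional.Properties using (shift; ∈-resp-↭)
import Data.List.Relation.Binary.Permutation.Setoid.Properties as Permₛ
open import Data.List.Reverse using (Reverse; []; _∶_∶ʳ_; reverseView)
open import Data.Product using (∃; _×_; _,_; proj₁; proj₂)
open import Data.Sum using (inj₁; inj₂)
open import Function using (_∘_; _⇔_; mk⇔; Equivalence)
open import Relation.Nullary using (Dec; ¬?)
open import Relation.Nullary.Decidable using (dec-true; dec-false; decidable-stable)
open import Relation.Binary.PropositionalEquality using (_≡_; _≢_; refl; sym; trans; cong; cong₂; subst; setoid; module ≡-Reasoning)

open Equivalence using (to; from)

-- General list facts, all obtained by moving one entry to the front.

module _ {A : Set} where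

  ∈-delete : ∀ xs {ys} {x y : A} → x ∈ xs ++ y ∷ ys → x ≢ y → x ∈ xs ++ ys
  ∈-delete xs {ys} x∈ x≢y with ∈-resp-↭ (shift _ xs ys) x∈
  ... | here x≡y = ⊥-elim (x≢y x≡y)
  ... | there x∈′ = x∈′

  ⊆-undelete : ∀ xs {ys} {y : A} → xs ++ ys ⊆ xs ++ y ∷ ys
  ⊆-undelete xs {ys} {y} = ⊆-respʳ-↭ (↭-sym (shift y xs ys)) (xs⊆x∷xs (xs ++ ys) y)

  unique-delete : ∀ xs {ys} {y : A} → Unique (xs ++ y ∷ ys) → y ∉ xs ++ ys × Unique (xs ++ ys)
  unique-delete xs {ys} u with Permₛ.Unique-resp-↭ (setoid A) (Permₛ.shift (setoid A) refl xs ys) u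
  ... | y∉ ∷ u′ = All¬⇒¬Any y∉ , u′

  unique-snoc : ∀ xs {y : A} → Unique (xs ∷ʳ y) → y ∉ xs × Unique xs
  unique-snoc xs u with unique-delete xs {[]} u
  ... | y∉ , u′ = (λ y∈ → y∉ (∈-++⁺ˡ y∈)) , subst Unique (++-identityʳ xs) u′

  take-length-++ : ∀ (xs ys : List A) → take (length xs) (xs ++ ys) ≡ xs
  take-length-++ [] ys = refl
  take-length-++ (x ∷ xs) ys = cong (x ∷_) (take-length-++ xs ys)

  drop-length-++ : ∀ (xs ys : List A) → drop (length xs) (xs ++ ys) ≡ ys
  drop-length-++ [] ys = refl
  drop-length-++ (x ∷ xs) ys = drop-length-++ xs ys

foldr-⊓-≤ : ∀ y zs → All (foldr _⊓_ y zs ≤_) (y ∷ zs)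
foldr-⊓-≤ y [] = ≤-refl ∷ []
foldr-⊓-≤ y (z ∷ zs) with foldr-⊓-≤ y zs
... | y≥ ∷ zs≥ = ≤-trans (m⊓n≤n z _) y≥ ∷ m⊓n≤m z _ ∷ All.map (≤-trans (m⊓n≤n z _)) zs≥

minL-≤ : ∀ {x} xs → x ∈ xs → minL xs ≤ x
minL-≤ (y ∷ zs) x∈ = lookup (foldr-⊓-≤ y zs) x∈

foldr-⊓-∈ : ∀ y zs → foldr _⊓_ y zs ∈ y ∷ zs
foldr-⊓-∈ y [] = here refl
foldr-⊓-∈ y (z ∷ zs) with ⊓-sel z (foldr _⊓_ y zs)
... | inj₁ eq = there (here eq)
... | inj₂ eq = subst (_∈ y ∷ z ∷ zs) (sym eq) (⊆-undelete [ y ] (foldr-⊓-∈ y zs))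

minL-∈ : ∀ {x} xs → x ∈ xs → minL xs ∈ xs
minL-∈ (y ∷ zs) _ = foldr-⊓-∈ y zs

minL-unique : ∀ {m} xs → m ∈ xs → (∀ {x} → x ∈ xs → m ≤ x) → minL xs ≡ m
minL-unique xs m∈ m≤ = ≤-antisym (minL-≤ xs m∈) (m≤ (minL-∈ xs m∈))

rangeL-++ : ∀ R R′ → rangeL (R ++ R′) ≡ rangeL R ++ rangeL R′
rangeL-++ = concatMap-++ elems

∈-rangeL⁺ : ∀ {x F R} → F ∈ R → x ∈ elems F → x ∈ rangeL R
∈-rangeL⁺ F∈ x∈ = ∈-concatMap⁺ elems (lose F∈ x∈)

∈-rangeL⁻ : ∀ {x} R → x ∈ rangeL R → ∃ λ F → F ∈ R × x ∈ elems F
∈-rangeL⁻ R x∈ = find (∈-concatMap⁻ elems x∈)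

rangeL-mono : ∀ {R R′} → R ⊆ R′ → rangeL R ⊆ rangeL R′
rangeL-mono = concatMap⁺ elems

∈-rangeL-++ˡ : ∀ R {R′ x} → x ∈ rangeL R → x ∈ rangeL (R ++ R′)
∈-rangeL-++ˡ R {R′} = rangeL-mono (xs⊆xs++ys R R′)

∈-rangeL-++ʳ : ∀ R {R′ x} → x ∈ rangeL R′ → x ∈ rangeL (R ++ R′)
∈-rangeL-++ʳ R {R′} = rangeL-mono (xs⊆ys++xs R′ R)

rangeB : List Registry → List ℕ
rangeB Bs = rangeL (concat Bs)

rangeB-++ : ∀ Bs₁ Bs₂ → rangeB (Bs₁ ++ Bs₂) ≡ rangeB Bs₁ ++ rangeB Bs₂
rangeB-++ Bs₁ Bs₂ = trans (cong rangeL (sym (concat-++ Bs₁ Bs₂))) (rangeL-++ (concat Bs₁) (concat Bs₂))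

rangeB-singlet : ∀ Bs₁ s Bs₂ → rangeB (Bs₁ ++ [ singlet s ] ∷ Bs₂) ≡ rangeB Bs₁ ++ s ∷ rangeB Bs₂
rangeB-singlet Bs₁ s Bs₂ = rangeB-++ Bs₁ ([ singlet s ] ∷ Bs₂)

∈-rangeB⁺ : ∀ {x B Bs} → B ∈ Bs → x ∈ rangeL B → x ∈ rangeB Bs
∈-rangeB⁺ B∈ = rangeL-mono (λ F∈ → ∈-concat⁺′ F∈ B∈)

record IsBlock (B rest : Registry) : Set where
  constructor isBlock
  field
    front : Registry
    final : Family
    minimum : ℕ
    shape : B ≡ front ++ [ final ]
    final-attains : fmin final ≡ minimum
    minimum∈final : minimum ∈ elems final
    front-misses : All (λ G → fmin G ≢ minimum) front
    minimum-below : ∀ {x} → x ∈ rangeL (B ++ rest) → minimum ≤ x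

IsBlockList : List Registry → Set
IsBlockList [] = ⊤
IsBlockList (B ∷ Bs) = IsBlock B (concat Bs) × IsBlockList Bs

minimum∈block : ∀ {B rest} (b : IsBlock B rest) → IsBlock.minimum b ∈ rangeL B
minimum∈block (isBlock front final m refl _ m∈ _ _) = ∈-rangeL⁺ (∈-++⁺ʳ front (here refl)) m∈

block-min : ∀ {B rest} (b : IsBlock B rest) → bmin B ≡ IsBlock.minimum b
block-min {B} b = minL-unique (rangeL B) (minimum∈block b) (IsBlock.minimum-below b ∘ ∈-rangeL-++ˡ B)

block-weaken : ∀ {B rest rest′} → rangeL rest′ ⊆ rangeL rest → IsBlock B rest → IsBlock B rest′
block-weaken {B} {rest′ = rest′} sub (isBlock front final m shape attains m∈ misses below) =
  isBlock front final m shape attains m∈ misses below′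
  where
  below′ : ∀ {x} → x ∈ rangeL (B ++ rest′) → m ≤ x
  below′ x∈ with ∈-++⁻ (rangeL B) (subst (_ ∈_) (rangeL-++ B rest′) x∈)
  ... | inj₁ x∈B = below (∈-rangeL-++ˡ B x∈B)
  ... | inj₂ x∈rest = below (∈-rangeL-++ʳ B (sub x∈rest))

blockList-min∈ : ∀ Bs → IsBlockList Bs → All (λ B → bmin B ∈ rangeL B) Bs
blockList-min∈ [] _ = []
blockList-min∈ (B ∷ Bs) (b , bs) =
  subst (_∈ rangeL B) (sym (block-min b)) (minimum∈block b) ∷ blockList-min∈ Bs bs

blockList-delete : ∀ Bs₁ {B Bs₂} → IsBlockList (Bs₁ ++ B ∷ Bs₂) → IsBlockList (Bs₁ ++ Bs₂)
blockList-delete [] (_ , bs) = bs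
blockList-delete (_ ∷ Bs₁) (b , bs) =
  block-weaken (rangeL-mono (concat⁺ (⊆-undelete Bs₁))) b , blockList-delete Bs₁ bs

-- Each block is nonempty, so there are at most as many blocks as families.
blockList-length : ∀ Bs → IsBlockList Bs → length Bs ≤ length (concat Bs)
blockList-length [] _ = z≤n
blockList-length (B ∷ Bs) (isBlock front final _ refl _ _ _ _ , bs) =
  ≤-trans (s≤s (blockList-length Bs bs))
          (subst (λ L → suc (length (concat Bs)) ≤ length L) (sym (++-assoc front [ final ] (concat Bs)))
                 (length-++-≤ʳ (final ∷ concat Bs) {front}))

cut-first : ∀ {m} front {F} rest → All (λ G → fmin G ≢ m) front → fmin F ≡ m →
            cut m (front ++ F ∷ rest) ≡ (front ++ [ F ] , rest)
cut-first [] {F} rest [] attains rewrite dec-true (fmin F ≟ _) attains = refl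
cut-first (G ∷ front) rest (misses ∷ front-misses) attains
  rewrite dec-false (fmin G ≟ _) misses =
    cong (λ split → G ∷ proj₁ split , proj₂ split) (cut-first front rest front-misses attains)

blocksF-step : ∀ k L {B rest} → L ≢ [] → cut (minL (rangeL L)) L ≡ (B , rest) →
               blocksF (suc k) L ≡ B ∷ blocksF k rest
blocksF-step k [] nonempty _ = ⊥-elim (nonempty refl)
blocksF-step k (H ∷ Hs) _ split with cut (minL (rangeL (H ∷ Hs))) (H ∷ Hs) | split
... | _ | refl = refl

blocksF-blockList : ∀ k Bs → IsBlockList Bs → length Bs ≤ k → blocksF k (concat Bs) ≡ Bs
blocksF-blockList zero [] _ _ = refl
blocksF-blockList (suc k) [] _ _ = refl
blocksF-blockList (suc k) (B ∷ Bs) (b@(isBlock front final m refl attains _ misses below) , bs) (s≤s len) =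
  trans (blocksF-step k L nonempty split) (cong (B ∷_) (blocksF-blockList k Bs bs len))
  where
  L : Registry
  L = B ++ concat Bs
  nonempty : L ≢ []
  nonempty L≡[] with ++-conicalʳ front (final ∷ concat Bs) (trans (sym (++-assoc front [ final ] (concat Bs))) L≡[])
  ... | ()
  minimum-of-L : minL (rangeL L) ≡ m
  minimum-of-L = minL-unique (rangeL L) (∈-rangeL-++ˡ B (minimum∈block b)) below
  split : cut (minL (rangeL L)) L ≡ (B , concat Bs)
  split rewrite minimum-of-L | ++-assoc front [ final ] (concat Bs) = cut-first front (concat Bs) misses attains

blocks-blockList : ∀ {Bs} → IsBlockList Bs → blocks (concat Bs) ≡ Bs
blocks-blockList {Bs} bs = blocksF-blockList _ Bs bs (blockList-length Bs bs)

-- Every well-formed family has an element; this is all the decomposition needs.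
Inhabited : Family → Set
Inhabited F = ∃ λ x → x ∈ elems F

BlockDecomposition : Registry → Set
BlockDecomposition L = ∃ λ Bs → IsBlockList Bs × concat Bs ≡ L

minimum-attained : ∀ {x} L → x ∈ rangeL L → Any (λ G → fmin G ≡ minL (rangeL L)) L
minimum-attained L x∈ with ∈-rangeL⁻ L (minL-∈ (rangeL L) x∈)
... | G , G∈ , m∈G = lose G∈ (≤-antisym (minL-≤ (elems G) m∈G)
                                         (minL-≤ (rangeL L) (∈-rangeL⁺ G∈ (minL-∈ (elems G) m∈G))))

first-attaining : ∀ {m} L → Any (λ G → fmin G ≡ m) L → First.FirstView (λ G → fmin G ≢ m) (λ G → fmin G ≡ m) L
first-attaining {m} L attained =
  toView (¬All⇒First (λ G → ¬? (fmin G ≟ m)) (decidable-stable (_ ≟ m)) (λ misses → All¬⇒¬Any misses attained))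

mutual
  decompose : ∀ k L → length L ≤ k → All Inhabited L → BlockDecomposition L
  decompose _ [] _ _ = [] , tt , refl
  decompose (suc k) L@(_ ∷ _) len inh@((_ , x∈H) ∷ _) =
    decompose-at k L len inh (first-attaining L (minimum-attained L (∈-rangeL⁺ {R = L} (here refl) x∈H)))

  decompose-at : ∀ k L → length L ≤ suc k → All Inhabited L →
                 First.FirstView (λ G → fmin G ≢ minL (rangeL L)) (λ G → fmin G ≡ minL (rangeL L)) L →
                 BlockDecomposition L
  decompose-at k L len inh (First._++_∷_ {front} {F} misses attains rest)
    with decompose k rest (s≤s⁻¹ (≤-trans (length-++-≤ʳ (F ∷ rest) {front}) len)) (All.tail (++⁻ʳ front inh))
  ... | Bs , bs , refl = (front ++ [ F ]) ∷ Bs , (block , bs) , ++-assoc front [ F ] (concat Bs)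
    where
    block : IsBlock (front ++ [ F ]) (concat Bs)
    block = isBlock front F _ refl attains
      (subst (_∈ elems F) attains (minL-∈ (elems F) (proj₂ (lookup inh (∈-++⁺ʳ front (here refl))))))
      misses
      (λ x∈ → minL-≤ (rangeL L) (subst (λ R → _ ∈ rangeL R) (++-assoc front [ F ] (concat Bs)) x∈))

blocks-decompose : ∀ R → All Inhabited R → IsBlockList (blocks R) × concat (blocks R) ≡ R
blocks-decompose R inh with decompose (length R) R ≤-refl inh
... | Bs , bs , refl = subst (λ Cs → IsBlockList Cs × concat Cs ≡ concat Bs) (sym (blocks-blockList bs)) (bs , refl)

cnt-above : ∀ s Bs → All (λ B → s ≤ bmin B) Bs → cnt s Bs ≡ 0
cnt-above s [] [] = refl
cnt-above s (B ∷ Bs) (s≤B ∷ s≤Bs)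
  rewrite cnt-above s Bs s≤Bs | dec-false (bmin B <? s) (≤⇒≯ s≤B) = refl

cnt-below-above : ∀ s Bs₁ Bs₂ → All (λ B → bmin B < s) Bs₁ → All (λ B → s ≤ bmin B) Bs₂ →
                  cnt s (Bs₁ ++ Bs₂) ≡ length Bs₁
cnt-below-above s [] Bs₂ [] above = cnt-above s Bs₂ above
cnt-below-above s (B ∷ []) Bs₂ (B<s ∷ []) above
  rewrite cnt-above s Bs₂ above | dec-true (bmin B <? s) B<s = refl
cnt-below-above s (B ∷ B′ ∷ Bs₁) Bs₂ (_ ∷ below) above
  rewrite cnt-below-above s (B′ ∷ Bs₁) Bs₂ below above = refl

insertSinglet-between : ∀ s Bs₁ Bs₂ → IsBlockList (Bs₁ ++ Bs₂) →
  All (λ B → bmin B < s) Bs₁ → All (λ B → s ≤ bmin B) Bs₂ →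
  insertSinglet s (concat (Bs₁ ++ Bs₂)) ≡ concat (Bs₁ ++ [ singlet s ] ∷ Bs₂)
insertSinglet-between s Bs₁ Bs₂ bs below above = begin
  insertSinglet s (concat Bs)
    ≡⟨ cong (λ Cs → insertAt (cnt s Cs) Cs) (blocks-blockList bs) ⟩
  insertAt (cnt s Bs) Bs
    ≡⟨ cong (λ c → insertAt c Bs) (cnt-below-above s Bs₁ Bs₂ below above) ⟩
  insertAt (length Bs₁) Bs
    ≡⟨ cong₂ (λ X Y → concat X ++ singlet s ∷ concat Y) (take-length-++ Bs₁ Bs₂) (drop-length-++ Bs₁ Bs₂) ⟩
  concat Bs₁ ++ concat ([ singlet s ] ∷ Bs₂)
    ≡⟨ concat-++ Bs₁ ([ singlet s ] ∷ Bs₂) ⟩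
  concat (Bs₁ ++ [ singlet s ] ∷ Bs₂) ∎
  where
  open ≡-Reasoning
  Bs : List Registry
  Bs = Bs₁ ++ Bs₂
  insertAt : ℕ → List Registry → Registry
  insertAt c Cs = concat (take c Cs) ++ singlet s ∷ concat (drop c Cs)

singlet-block-position : ∀ s Bs₁ Bs₂ → IsBlockList (Bs₁ ++ [ singlet s ] ∷ Bs₂) → s ∉ rangeB Bs₁ →
  All (λ B → bmin B < s) Bs₁ × All (λ B → s ≤ bmin B) Bs₂
singlet-block-position s [] Bs₂ (isBlock [] _ _ refl refl _ _ below , bs) _ =
  [] , tabulate (λ B∈ → below (there (∈-rangeB⁺ B∈ (lookup (blockList-min∈ Bs₂ bs) B∈))))
singlet-block-position s [] Bs₂ (isBlock (_ ∷ []) _ _ () _ _ _ _ , _) _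
singlet-block-position s [] Bs₂ (isBlock (_ ∷ _ ∷ _) _ _ () _ _ _ _ , _) _
singlet-block-position s (B ∷ Bs₁) Bs₂ (b , bs) s∉ with singlet-block-position s Bs₁ Bs₂ bs (s∉ ∘ ∈-rangeL-++ʳ B)
... | below , above = B<s ∷ below , above
  where
  open IsBlock b using (minimum-below)
  s∈ : s ∈ rangeL (B ++ concat (Bs₁ ++ [ singlet s ] ∷ Bs₂))
  s∈ = ∈-rangeL-++ʳ B (subst (s ∈_) (sym (rangeB-singlet Bs₁ s Bs₂)) (∈-insert (rangeB Bs₁)))
  B<s : bmin B < s
  B<s = subst (_< s) (sym (block-min b))
          (≤∧≢⇒< (minimum-below s∈) (λ m≡s → s∉ (∈-rangeL-++ˡ B (subst (_∈ rangeL B) m≡s (minimum∈block b)))))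

removeSinglets-skip : ∀ R {s} R′ → removeSinglets (R ++ singlet s ∷ R′) ≡ removeSinglets (R ++ R′)
removeSinglets-skip [] R′ = refl
removeSinglets-skip (singlet _ ∷ R) R′ = removeSinglets-skip R R′
removeSinglets-skip (nonsinglet b r ∷ R) R′ = cong (nonsinglet b r ∷_) (removeSinglets-skip R R′)

removeSinglets-⊆ : ∀ R → removeSinglets R ⊆ R
removeSinglets-⊆ (singlet _ ∷ R) F∈ = there (removeSinglets-⊆ R F∈)
removeSinglets-⊆ (nonsinglet b r ∷ R) (here refl) = here refl
removeSinglets-⊆ (nonsinglet b r ∷ R) (there F∈) = there (removeSinglets-⊆ R F∈)

removeSinglets-keeps : ∀ {b r} R → nonsinglet b r ∈ R → nonsinglet b r ∈ removeSinglets R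
removeSinglets-keeps (singlet _ ∷ R) (there F∈) = removeSinglets-keeps R F∈
removeSinglets-keeps (nonsinglet b r ∷ R) (here refl) = here refl
removeSinglets-keeps (nonsinglet b r ∷ R) (there F∈) = there (removeSinglets-keeps R F∈)

removeSinglets-id : ∀ R → (∀ {s} → singlet s ∉ R) → removeSinglets R ≡ R
removeSinglets-id [] _ = refl
removeSinglets-id (singlet s ∷ R) no-singlet = ⊥-elim (no-singlet (here refl))
removeSinglets-id (nonsinglet b r ∷ R) no-singlet = cong (nonsinglet b r ∷_) (removeSinglets-id R (no-singlet ∘ there))

removeSinglets-skip-block : ∀ Bs₁ {s} Bs₂ →
  removeSinglets (concat (Bs₁ ++ [ singlet s ] ∷ Bs₂)) ≡ removeSinglets (concat (Bs₁ ++ Bs₂))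
removeSinglets-skip-block Bs₁ {s} Bs₂ = begin
  removeSinglets (concat (Bs₁ ++ [ singlet s ] ∷ Bs₂)) ≡⟨ cong removeSinglets (sym (concat-++ Bs₁ _)) ⟩
  removeSinglets (concat Bs₁ ++ singlet s ∷ concat Bs₂) ≡⟨ removeSinglets-skip (concat Bs₁) (concat Bs₂) ⟩
  removeSinglets (concat Bs₁ ++ concat Bs₂)            ≡⟨ cong removeSinglets (concat-++ Bs₁ Bs₂) ⟩
  removeSinglets (concat (Bs₁ ++ Bs₂))                 ∎
  where open ≡-Reasoning

reinsert-snoc : ∀ S s R → reinsert (S ∷ʳ s) R ≡ insertSinglet s (reinsert S R)
reinsert-snoc [] s R = refl
reinsert-snoc (t ∷ S) s R = reinsert-snoc S s (insertSinglet t R)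

SingletBlocks : List Registry → Set
SingletBlocks Bs = ∀ {B} → B ∈ Bs → ∀ {s} → singlet s ∈ B → B ≡ [ singlet s ]

singlet-block : ∀ {Bs s} → SingletBlocks Bs → singlet s ∈ concat Bs → [ singlet s ] ∈ Bs
singlet-block {Bs} alone s∈ with ∈-concat⁻′ Bs s∈
... | B , s∈B , B∈ = subst (_∈ Bs) (alone B∈ s∈B) B∈

record Separated (Bs : List Registry) : Set where
  field
    blockList : IsBlockList Bs
    distinct : Unique (rangeB Bs)
    alone : SingletBlocks Bs

SingletsOf : List ℕ → List Registry → Set
SingletsOf S Bs = ∀ x → x ∈ S ⇔ [ singlet x ] ∈ Bs

separated-delete : ∀ Bs₁ s Bs₂ → Separated (Bs₁ ++ [ singlet s ] ∷ Bs₂) →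
  Separated (Bs₁ ++ Bs₂) × s ∉ rangeB (Bs₁ ++ Bs₂) ×
  All (λ B → bmin B < s) Bs₁ × All (λ B → s ≤ bmin B) Bs₂
separated-delete Bs₁ s Bs₂ sep =
  record { blockList = blockList-delete Bs₁ blockList ; distinct = distinct′ ; alone = alone ∘ ⊆-undelete Bs₁ } ,
  s∉′ ,
  singlet-block-position s Bs₁ Bs₂ blockList (s∉ ∘ ∈-++⁺ˡ)
  where
  open Separated sep
  s∉ : s ∉ rangeB Bs₁ ++ rangeB Bs₂
  s∉ = proj₁ (unique-delete (rangeB Bs₁) (subst Unique (rangeB-singlet Bs₁ s Bs₂) distinct))
  s∉′ : s ∉ rangeB (Bs₁ ++ Bs₂)
  s∉′ = s∉ ∘ subst (s ∈_) (rangeB-++ Bs₁ Bs₂)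
  distinct′ : Unique (rangeB (Bs₁ ++ Bs₂))
  distinct′ = subst Unique (sym (rangeB-++ Bs₁ Bs₂))
    (proj₂ (unique-delete (rangeB Bs₁) (subst Unique (rangeB-singlet Bs₁ s Bs₂) distinct)))

singletsOf-delete : ∀ S s Bs₁ Bs₂ → s ∉ S → s ∉ rangeB (Bs₁ ++ Bs₂) →
  SingletsOf (S ∷ʳ s) (Bs₁ ++ [ singlet s ] ∷ Bs₂) → SingletsOf S (Bs₁ ++ Bs₂)
singletsOf-delete S s Bs₁ Bs₂ s∉S s∉Bs singlets x = mk⇔ listed unlisted
  where
  listed : x ∈ S → [ singlet x ] ∈ Bs₁ ++ Bs₂
  listed x∈ = ∈-delete Bs₁ (to (singlets x) (∈-++⁺ˡ x∈)) λ { refl → s∉S x∈ }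
  unlisted : [ singlet x ] ∈ Bs₁ ++ Bs₂ → x ∈ S
  unlisted x∈ with ∈-++⁻ S (from (singlets x) (⊆-undelete Bs₁ x∈))
  ... | inj₁ x∈S = x∈S
  ... | inj₂ (here refl) = ⊥-elim (s∉Bs (∈-rangeB⁺ x∈ (here refl)))

reinsert-singlets : ∀ {S} → Reverse S → ∀ Bs → Separated Bs → Unique S → SingletsOf S Bs →
                    reinsert S (removeSinglets (concat Bs)) ≡ concat Bs
reinsert-singlets [] Bs sep _ singlets =
  removeSinglets-id (concat Bs) (λ s∈ → ¬Any[] (from (singlets _) (singlet-block (Separated.alone sep) s∈)))
reinsert-singlets (S ∶ S-view ∶ʳ s) Bs sep unique singlets
  with ∈-∃++ (to (singlets s) (∈-++⁺ʳ S (here refl)))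
... | Bs₁ , Bs₂ , refl with separated-delete Bs₁ s Bs₂ sep | unique-snoc S unique
...   | sep′ , s∉Bs , below , above | s∉S , unique′ = begin
  reinsert (S ∷ʳ s) (removeSinglets (concat (Bs₁ ++ [ singlet s ] ∷ Bs₂)))
    ≡⟨ reinsert-snoc S s _ ⟩
  insertSinglet s (reinsert S (removeSinglets (concat (Bs₁ ++ [ singlet s ] ∷ Bs₂))))
    ≡⟨ cong (insertSinglet s ∘ reinsert S) (removeSinglets-skip-block Bs₁ Bs₂) ⟩
  insertSinglet s (reinsert S (removeSinglets (concat (Bs₁ ++ Bs₂))))
    ≡⟨ cong (insertSinglet s) (reinsert-singlets S-view (Bs₁ ++ Bs₂) sep′ unique′
                                 (singletsOf-delete S s Bs₁ Bs₂ s∉S s∉Bs singlets)) ⟩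
  insertSinglet s (concat (Bs₁ ++ Bs₂))
    ≡⟨ insertSinglet-between s Bs₁ Bs₂ (Separated.blockList sep′) below above ⟩
  concat (Bs₁ ++ [ singlet s ] ∷ Bs₂) ∎
  where open ≡-Reasoning

outside⇒singlet : ∀ {x} R → x ∈ rangeL R → x ∉ rangeL (removeSinglets R) → singlet x ∈ R
outside⇒singlet R x∈ x∉ with ∈-rangeL⁻ R x∈
... | singlet _ , F∈ , here refl = F∈
... | nonsinglet b r , F∈ , x∈F = ⊥-elim (x∉ (∈-rangeL⁺ (removeSinglets-keeps R F∈) x∈F))

singlet⇒outside : ∀ {x} R → Unique (rangeL R) → singlet x ∈ R → x ∉ rangeL (removeSinglets R)
singlet⇒outside {x} R distinct x∈ with ∈-∃++ x∈
... | R₁ , R₂ , refl = λ x∈′ → x∉ (subst (x ∈_) (rangeL-++ R₁ R₂)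
        (rangeL-mono (removeSinglets-⊆ (R₁ ++ R₂)) (subst (λ R → x ∈ rangeL R) (removeSinglets-skip R₁ R₂) x∈′)))
  where
  x∉ : x ∉ rangeL R₁ ++ rangeL R₂
  x∉ = proj₁ (unique-delete (rangeL R₁) (subst Unique (rangeL-++ R₁ (singlet x ∷ R₂)) distinct))

∈-suc-upTo : ∀ {x n} → x ∈ map suc (upTo n) ⇔ (1 ≤ x × x ≤ n)
∈-suc-upTo = mk⇔ inRange listed
  where
  inRange : ∀ {x n} → x ∈ map suc (upTo n) → 1 ≤ x × x ≤ n
  inRange x∈ with ∈-map⁻ suc x∈
  ... | y , y∈ , refl = s≤s z≤n , ∈-upTo⁻ y∈
  listed : ∀ {x n} → 1 ≤ x × x ≤ n → x ∈ map suc (upTo n)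
  listed {suc y} (_ , y<n) = ∈-map⁺ suc (∈-upTo⁺ y<n)

complement-singlets : ∀ n R → Unique (rangeL R) → HasRange R n →
  ∀ x → x ∈ complementIn n (removeSinglets R) ⇔ singlet x ∈ R
complement-singlets n R distinct range x = mk⇔ singlet-of outside
  where
  outside? : (y : ℕ) → Dec (y ∉ rangeL (removeSinglets R))
  outside? = λ y → ¬? (y ∈? rangeL (removeSinglets R))
  singlet-of : x ∈ complementIn n (removeSinglets R) → singlet x ∈ R
  singlet-of x∈ with ∈-filter⁻ outside? {xs = map suc (upTo n)} x∈
  ... | x∈range , x∉ = outside⇒singlet R (proj₂ (range x) (to ∈-suc-upTo x∈range)) x∉
  outside : singlet x ∈ R → x ∈ complementIn n (removeSinglets R)
  outside x∈ = ∈-filter⁺ outside? (from ∈-suc-upTo (proj₁ (range x) (∈-rangeL⁺ x∈ (here refl))))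
                                  (singlet⇒outside R distinct x∈)

unique-complement : ∀ n R → Unique (complementIn n R)
unique-complement n R = filter⁺ (λ x → ¬? (x ∈? rangeL R)) (map⁺ suc-injective (upTo⁺ n))

inhabited : ∀ {F} → WFFamily F → Inhabited F
inhabited {singlet s} _ = s , here refl
inhabited {nonsinglet (x ∷ _) _} (_ , nonEmpty , _) = x , here refl

blocks-separated : ∀ R → WFRegistry R → SingletsAreBlocks R → Separated (blocks R) × concat (blocks R) ≡ R
blocks-separated R (wf , distinct) alone with blocks-decompose R (All.map inhabited wf)
... | blockList , concat≡R = record
  { blockList = blockList ; distinct = subst (Unique ∘ rangeL) (sym concat≡R) distinct ; alone = alone } , concat≡R

singletsOf-concat : ∀ {S Bs} → SingletBlocks Bs → (∀ x → x ∈ S ⇔ singlet x ∈ concat Bs) → SingletsOf S Bs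
singletsOf-concat alone singlets x =
  mk⇔ (singlet-block alone ∘ to (singlets x)) (from (singlets x) ∘ λ x∈ → ∈-concat⁺′ (here refl) x∈)

mainTheorem6 : (n : ℕ) (R : Registry) → WFRegistry R → HasRange R n → SingletsAreBlocks R
    → reinsert (complementIn n (removeSinglets R)) (removeSinglets R) ≡ R
mainTheorem6 n R wfR@(_ , distinct) range alone with blocks-separated R wfR alone
... | separated , concat≡R = begin
  reinsert C (removeSinglets R)
    ≡⟨ cong (reinsert C ∘ removeSinglets) (sym concat≡R) ⟩
  reinsert C (removeSinglets (concat (blocks R)))
    ≡⟨ reinsert-singlets (reverseView C) (blocks R) separated (unique-complement n (removeSinglets R)) singlets ⟩
  concat (blocks R)
    ≡⟨ concat≡R ⟩
  R ∎
  where
  open ≡-Reasoning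
  C : List ℕ
  C = complementIn n (removeSinglets R)
  singlets : SingletsOf C (blocks R)
  singlets = singletsOf-concat alone λ x →
    subst (λ R′ → x ∈ C ⇔ singlet x ∈ R′) (sym concat≡R) (complement-singlets n R distinct range x)
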